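{- Let $I=(i_0,\dots,i_{k-1})\in\mathcal{I}'_k$, $h\in\mathbb{Z}$, $d,\lambda\in\mathbb{N}$ and $\delta\in\{0,\dots,q^{m-1}-1\}$. For $0\le\varepsilon<q^{m-1}$ put $J_{\varepsilon,\delta}=(i_\ell+\ell\delta+\varepsilon)_{0\le\ell\le k-1}$. Then $J_{\varepsilon,\delta}\in\mathcal{I}_k$ and $$H_\lambda^I(h,q^{m-1}d+\delta)=\frac1{q^{m-1}}\sum_{\varepsilon=0}^{q^{m-1}-1}\exp\Bigl(-2\pi i\frac{h\varepsilon}{q^{\lambda+m-1}}\Bigr)G_\lambda^{J_{\varepsilon,\delta}}(h,d).$$
   Context: Fix $q\ge2$, $m\ge1$, $F:\{0,\dots,q-1\}^m\to\mathbb{Z}$ with $F(0,\dots,0)=0$; write $F(n):=F(\varepsilon_{m-1}(n),\dots,\varepsilon_0(n))$ where $\varepsilon_j(n)$ is the $j$-th base-$q$ digit of $n\ge0$ ($\varepsilon_j(n)=0$ for $j<0$). For $\lambda\ge0$ let $b_\lambda(n)=\sum_{j\in\mathbb{Z},\,j<\lambda}F(\varepsilon_{j+m-1}(n),\dots,\varepsilon_j(n))$ for $n\ge0$; it is $q^{\lambda+m-1}$-periodic and is extended to a $q^{\lambda+m-1}$-periodic function on $\mathbb{Z}$. Fix $k\ge1$, $m'\ge1$ and $\alpha_0,\dots,\alpha_{k-1}\in\{\frac0{m'},\dots,\frac{m'-1}{m'}\}$; write $e(x)=\exp(2\pi i x)$. $\mathcal{I}_k$ is the set of integer vectors $(i_0,\dots,i_{k-1})$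 with $0\le i_0<q^{m-1}$ and $i_{\ell-1}\le i_\ell\le i_{\ell-1}+q^{m-1}$ for $1\le\ell\le k-1$; $\mathcal{I}'_k$ is the set of integer vectors with $i_0=0$ and $i_{\ell-1}\le i_\ell\le i_{\ell-1}+1$. For $I\in\mathcal{I}'_k$: $H_\lambda^I(h,d)=\frac1{q^{\lambda+m-1}}\sum_{0\le u<q^{\lambda+m-1}}e\bigl(\sum_{\ell=0}^{k-1}\alpha_\ell b_\lambda(u+\ell d+i_\ell)-huq^{ -\lambda-m+1}\bigr)$. For $I\in\mathcal{I}_k$: $G_\lambda^I(h,d)=\frac1{q^\lambda}\sum_{0\le u<q^\lambda}e\bigl(\sum_{\ell=0}^{k-1}\alpha_\ell b_\lambda(q^{m-1}(u+\ell d)+i_\ell)-huq^{ -\lambda}\bigr)$. -}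

module Defs where

open import Level using (Level)
open import Function using (_∘_)
open import Data.Nat as ℕ using (ℕ; zero; suc; _≤_; _<_; _∸_; _^_; NonZero; z≤n; s≤s)
import Data.Nat.Properties as ℕP
open import Data.Nat.DivMod using (_/_; _%_; m%n<n)
open import Data.Fin using (Fin; toℕ; fromℕ<)
open import Data.Integer as ℤ using (ℤ; +_)
open import Data.Rational as ℚ using (ℚ)
open import Data.Product using (_×_)
open import Relation.Binary.PropositionalEquality using (_≡_)
open import Algebra.Bundles using (CommutativeRing)
open import Relation.Nullary using (yes; no)

-- An argument tuple (x_0,…,x_{m-1}) of F is a function Fin m → Fin q;
-- F(ε_{m-1}(n),…,ε_0(n)) means argument t is the digit ε_{m-1-t}(n).
record Params : Set where
  field
    q      : ℕ
    q≥2    : 2 ≤ q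
    m      : ℕ
    m≥1    : 1 ≤ m
    F      : (Fin m → Fin q) → ℤ
    k      : ℕ
    k≥1    : 1 ≤ k
    m'     : ℕ
    m'≥1   : 1 ≤ m'
    a      : Fin k → ℕ
    a<m'   : ∀ ℓ → a ℓ < m'

  q>0 : 0 < q
  q>0 = ℕP.<-≤-trans (s≤s z≤n) q≥2

  instance
    q-nz : NonZero q
    q-nz = ℕ.>-nonZero q>0

  fzero : Fin q
  fzero = fromℕ< q>0

  field
    F0     : F (λ _ → fzero) ≡ + 0

  dig : ℕ → ℕ → Fin q
  dig zero    n = fromℕ< (m%n<n n q)
  dig (suc j) n = dig j (n / q)

  -- digit with possibly negative index J - t (value 0 if J < t)
  digitShift : ℕ → ℕ → ℕ → Fin q
  digitShift J t n with t ℕ.≤? J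
  ... | yes _ = dig (J ∸ t) n
  ... | no  _ = fzero

  -- the window (ε_{j+m-1}(n),…,ε_j(n)) with J = j + m - 1
  window : ℕ → ℕ → (Fin m → Fin q)
  window J n t = digitShift J (toℕ t) n

  sumℤ : ℕ → (ℕ → ℤ) → ℤ
  sumℤ zero    f = + 0
  sumℤ (suc N) f = sumℤ N f ℤ.+ f N

  -- b_λ(n) = Σ_{j < λ} F(ε_{j+m-1}(n),…,ε_j(n)); the terms with j ≤ -m
  -- vanish since F(0,…,0) = 0, so we sum over J = j + m - 1 ∈ [0, λ+m-1).
  b : ℕ → ℕ → ℤ
  b λ′ n = sumℤ (λ′ ℕ.+ (m ∸ 1)) (λ J → F (window J n))

  α : Fin k → ℚ
  α ℓ = ℚ._/_ (+ a ℓ) m' {{ℕ.>-nonZero m'≥1}}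

  divPow : ℤ → ℕ → ℚ
  divPow z n = ℚ._/_ z (q ^ n) {{ℕP.m^n≢0 q n}}

  InI' : (Fin k → ℕ) → Set
  InI' I = (∀ ℓ → toℕ ℓ ≡ 0 → I ℓ ≡ 0)
         × (∀ ℓ ℓ' → toℕ ℓ' ≡ suc (toℕ ℓ) → (I ℓ ≤ I ℓ') × (I ℓ' ≤ I ℓ ℕ.+ 1))

  InI : (Fin k → ℕ) → Set
  InI I = (∀ ℓ → toℕ ℓ ≡ 0 → I ℓ < q ^ (m ∸ 1))
        × (∀ ℓ ℓ' → toℕ ℓ' ≡ suc (toℕ ℓ) → (I ℓ ≤ I ℓ') × (I ℓ' ≤ I ℓ ℕ.+ q ^ (m ∸ 1)))

toℚ : ℤ → ℚ
toℚ z = z ℚ./ 1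

sumFinℚ : ∀ {k} → (Fin k → ℚ) → ℚ
sumFinℚ {zero}  f = ℚ.0ℚ
sumFinℚ {suc k} f = f Fin.zero ℚ.+ sumFinℚ (f ∘ Fin.suc)
  where import Data.Fin as Fin

module _ {c ℓ : Level} (R : CommutativeRing c ℓ) where
  open CommutativeRing R

  sumR : ℕ → (ℕ → Carrier) → Carrier
  sumR zero    f = 0#
  sumR (suc N) f = sumR N f + f N

  natR : ℕ → Carrier
  natR zero    = 0#
  natR (suc n) = 1# + natR n

  powR : Carrier → ℕ → Carrier
  powR x zero    = 1#
  powR x (suc n) = x * powR x n

  IsCharacter : (ℚ → Carrier) → Set ℓ
  IsCharacter e = (∀ x y → e (x ℚ.+ y) ≈ e x * e y) × (e ℚ.1ℚ ≈ 1#)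

  module _ (P : Params) (e : ℚ → Carrier) (qinv : Carrier) where
    open Params P

    -- H_λ^I(h, D), with 1/q^{λ+m-1} written as qinv^{λ+m-1}
    H : ℕ → (Fin k → ℕ) → ℤ → ℕ → Carrier
    H λ′ I h D =
      powR qinv N * sumR (q ^ N) (λ u →
        e (sumFinℚ (λ l → α l ℚ.* toℚ (b λ′ (u ℕ.+ toℕ l ℕ.* D ℕ.+ I l)))
           ℚ.- divPow (h ℤ.* + u) N))
      where N = λ′ ℕ.+ (m ∸ 1)

    G : ℕ → (Fin k → ℕ) → ℤ → ℕ → Carrier
    G λ′ I h d =
      powR qinv λ′ * sumR (q ^ λ′) (λ u →
        e (sumFinℚ (λ l → α l ℚ.* toℚ (b λ′ (q ^ (m ∸ 1) ℕ.* (u ℕ.+ toℕ l ℕ.* d) ℕ.+ I l)))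
           ℚ.- divPow (h ℤ.* + u) λ′))

module _ {c ℓ : Level} (R : CommutativeRing c ℓ) where
  Car : Set c
  Car = CommutativeRing.Carrier R

  eqR : Car → Car → Set ℓ
  eqR = CommutativeRing._≈_ R

  mulR : Car → Car → Car
  mulR = CommutativeRing._*_ R

  oneR : Car
  oneR = CommutativeRing.1# R

module Submission where

-- Write N = λ + m - 1, so q^N = q^λ · B.  Every u < q^N is uniquely
-- u = B u' + ε with u' < q^λ and ε < B.  For such u the argument of every
-- b_λ in H_λ^I(h, D) is
--     (B u' + ε) + ℓ D + i_ℓ = B (u' + ℓ d) + (i_ℓ + ℓ δ + ε) = B (u' + ℓ d) + J_ℓ,
-- which is exactly the argument occurring in G_λ^J(h, d), and the phase
-- splits as h (B u' + ε) / q^N = h u' / q^λ + h ε / q^N.  Since e is a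
-- character, the summand of H at u equals e(-hε/q^N) times the summand of
-- G^{J_ε} at u'.  Regrouping the sum over u into blocks, exchanging the two
-- finite sums and splitting qinv^N = qinv^λ · qinv^{m-1} gives the identity.
-- Membership J_ε ∈ 𝓘_k is elementary arithmetic from I ∈ 𝓘'_k, δ, ε < B.

open import Defs
open import Data.Nat using (ℕ; _<_; _∸_; _^_; _+_; _*_)
open import Data.Fin using (Fin; toℕ)
open import Data.Integer as ℤ using (ℤ; +_)
open import Data.Rational as ℚ using (ℚ)
open import Data.Product using (_×_)
open import Algebra.Bundles using (CommutativeRing)

open import Data.Nat as ℕ using (suc; zero; NonZero)
import Data.Nat.Properties as ℕP
import Data.Integer.Properties as ℤP
import Data.Rational.Properties as ℚP
import Data.Rational.Unnormalised as U
import Data.Rational.Unnormalised.Properties as UP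
open import Data.Product using (_,_)
open import Relation.Binary.PropositionalEquality as PE using (_≡_)
import Data.Integer.Solver as ℤSolver
import Data.Rational.Solver as ℚSolver
import Data.Nat.Solver as ℕSolver
import Algebra.Properties.CommutativeSemigroup as CommSemigroupProps
import Relation.Binary.Reasoning.Setoid as SetoidReasoning

-- (z B + w) / (P B) = z / P + w / (P B): the identity that splits the phase
-- h (B u + ε) / q^{λ+m-1} into h u / q^λ + h ε / q^{λ+m-1}.
fraction-split : ∀ (z w : ℤ) (P B : ℕ) .{{_ : NonZero P}} .{{_ : NonZero B}} →
  ℚ._/_ (z ℤ.* + B ℤ.+ w) (P ℕ.* B) {{ℕP.m*n≢0 P B}}
    ≡ z ℚ./ P ℚ.+ ℚ._/_ w (P ℕ.* B) {{ℕP.m*n≢0 P B}}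
fraction-split z w (suc p) (suc b) = ℚP.toℚᵘ-injective (begin
    ℚ.toℚᵘ ((z ℤ.* B ℤ.+ w) ℚ./ PB)   ≈⟨ ℚP.toℚᵘ-fromℚᵘ (U.mkℚᵘ (z ℤ.* B ℤ.+ w) (ℕ.pred PB)) ⟩
    U.mkℚᵘ (z ℤ.* B ℤ.+ w) (ℕ.pred PB)  ≈⟨ U.*≡* cross-multiplied ⟩
    U.mkℚᵘ z p U.+ U.mkℚᵘ w (ℕ.pred PB) ≈⟨ UP.≃-sym (UP.+-cong (ℚP.toℚᵘ-fromℚᵘ (U.mkℚᵘ z p))
                                                            (ℚP.toℚᵘ-fromℚᵘ (U.mkℚᵘ w (ℕ.pred PB)))) ⟩
    ℚ.toℚᵘ (z ℚ./ suc p) U.+ ℚ.toℚᵘ (w ℚ./ PB)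
                                         ≈⟨ UP.≃-sym (ℚP.toℚᵘ-homo-+ (z ℚ./ suc p) (w ℚ./ PB)) ⟩
    ℚ.toℚᵘ (z ℚ./ suc p ℚ.+ w ℚ./ PB)  ∎)
  where
  open SetoidReasoning UP.≃-setoid
  PB = suc p ℕ.* suc b
  P′ = + suc p
  B = + suc b
  denominator : + PB ≡ P′ ℤ.* B
  denominator = ℤP.pos-* (suc p) (suc b)
  ring-identity : ∀ z w P′ B → (z ℤ.* B ℤ.+ w) ℤ.* (P′ ℤ.* (P′ ℤ.* B))
                             ≡ (z ℤ.* (P′ ℤ.* B) ℤ.+ w ℤ.* P′) ℤ.* (P′ ℤ.* B)
  ring-identity = solve 4 (λ z w P′ B → (z :* B :+ w) :* (P′ :* (P′ :* B))
                                      := (z :* (P′ :* B) :+ w :* P′) :* (P′ :* B)) PE.refl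
    where open ℤSolver.+-*-Solver
  cross-multiplied : (z ℤ.* B ℤ.+ w) ℤ.* + (suc p ℕ.* PB)
                   ≡ (z ℤ.* + PB ℤ.+ w ℤ.* P′) ℤ.* + PB
  cross-multiplied = PE.trans
    (PE.cong ((z ℤ.* B ℤ.+ w) ℤ.*_) (PE.trans (ℤP.pos-* (suc p) PB) (PE.cong (P′ ℤ.*_) denominator)))
    (PE.trans (ring-identity z w P′ B)
      (PE.sym (PE.cong₂ (λ s t → (z ℤ.* s ℤ.+ w ℤ.* P′) ℤ.* t) denominator denominator)))

sumFinℚ-cong : ∀ {k} {f g : Fin k → ℚ} → (∀ i → f i ≡ g i) → sumFinℚ f ≡ sumFinℚ g
sumFinℚ-cong {zero}  f≡g = PE.refl
sumFinℚ-cong {suc k} f≡g = PE.cong₂ ℚ._+_ (f≡g Fin.zero) (sumFinℚ-cong (λ i → f≡g (Fin.suc i)))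
  where import Data.Fin as Fin

module RingSums {c r} (R : CommutativeRing c r) where
  open CommutativeRing R renaming (_+_ to _⊕_; _*_ to _⊛_)
  open SetoidReasoning setoid

  Σ : ℕ → (ℕ → Carrier) → Carrier
  Σ = sumR R

  sum-cong : ∀ N {f g : ℕ → Carrier} → (∀ i → f i ≈ g i) → Σ N f ≈ Σ N g
  sum-cong zero    f≈g = refl
  sum-cong (suc N) f≈g = +-cong (sum-cong N f≈g) (f≈g N)

  sum-*ˡ : ∀ N x f → x ⊛ Σ N f ≈ Σ N (λ i → x ⊛ f i)
  sum-*ˡ zero    x f = zeroʳ x
  sum-*ˡ (suc N) x f = trans (distribˡ x (Σ N f) (f N)) (+-cong (sum-*ˡ N x f) refl)

  sum-0 : ∀ N → Σ N (λ _ → 0#) ≈ 0#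
  sum-0 zero    = refl
  sum-0 (suc N) = trans (+-identityʳ _) (sum-0 N)

  sum-+ : ∀ N f g → Σ N (λ i → f i ⊕ g i) ≈ Σ N f ⊕ Σ N g
  sum-+ zero    f g = sym (+-identityˡ 0#)
  sum-+ (suc N) f g = trans (+-cong (sum-+ N f g) refl) (interchange (Σ N f) (Σ N g) (f N) (g N))
    where open CommSemigroupProps +-commutativeSemigroup using (interchange)

  sum-++ : ∀ X Y f → Σ (X ℕ.+ Y) f ≈ Σ X f ⊕ Σ Y (λ i → f (X ℕ.+ i))
  sum-++ X zero    f = trans (reflexive (PE.cong (λ n → Σ n f) (ℕP.+-identityʳ X))) (sym (+-identityʳ _))
  sum-++ X (suc Y) f = trans (reflexive (PE.cong (λ n → Σ n f) (ℕP.+-suc X Y)))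
    (trans (+-cong (sum-++ X Y f) refl) (+-assoc _ _ _))

  -- Division with remainder: every i < A B is uniquely B u + ε with u < A, ε < B.
  sum-blocks : ∀ A B f → Σ (A ℕ.* B) f ≈ Σ A (λ u → Σ B (λ ε → f (B ℕ.* u ℕ.+ ε)))
  sum-blocks zero    B f = refl
  sum-blocks (suc A) B f = begin
    Σ (B ℕ.+ A ℕ.* B) f                            ≡⟨ PE.cong (λ n → Σ n f) (ℕP.+-comm B (A ℕ.* B)) ⟩
    Σ (A ℕ.* B ℕ.+ B) f                            ≈⟨ sum-++ (A ℕ.* B) B f ⟩
    Σ (A ℕ.* B) f ⊕ Σ B (λ ε → f (A ℕ.* B ℕ.+ ε))  ≈⟨ +-cong (sum-blocks A B f) (sum-cong B last-block) ⟩
    Σ A (λ u → Σ B (λ ε → f (B ℕ.* u ℕ.+ ε))) ⊕ Σ B (λ ε → f (B ℕ.* A ℕ.+ ε)) ∎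
    where
    last-block : ∀ ε → f (A ℕ.* B ℕ.+ ε) ≈ f (B ℕ.* A ℕ.+ ε)
    last-block ε = reflexive (PE.cong (λ t → f (t ℕ.+ ε)) (ℕP.*-comm A B))

  sum-swap : ∀ A B (g : ℕ → ℕ → Carrier) → Σ A (λ u → Σ B (g u)) ≈ Σ B (λ ε → Σ A (λ u → g u ε))
  sum-swap zero    B g = sym (sum-0 B)
  sum-swap (suc A) B g = trans (+-cong (sum-swap A B g) refl) (sym (sum-+ B _ _))

  pow-+ : ∀ x a b → powR R x (a ℕ.+ b) ≈ powR R x a ⊛ powR R x b
  pow-+ x zero    b = sym (*-identityˡ _)
  pow-+ x (suc a) b = trans (*-cong refl (pow-+ x a b)) (sym (*-assoc _ _ _))

module _ (P : Params) where
  open Params P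

  -- If I ∈ 𝓘'_k and δ, ε < q^{m-1}, then J = (i_ℓ + ℓ δ + ε)_ℓ ∈ 𝓘_k:
  -- J_0 = ε, and each step J_{ℓ+1} - J_ℓ = (i_{ℓ+1} - i_ℓ) + δ lies in [0, 1 + δ] ⊆ [0, q^{m-1}].
  shifted-in-I : ∀ (I : Fin k → ℕ) → InI' I → ∀ δ ε → δ < q ^ (m ∸ 1) → ε < q ^ (m ∸ 1) →
                 InI (λ l → I l + toℕ l * δ + ε)
  shifted-in-I I (I₀≡0 , I-step) δ ε δ<B ε<B = first-entry , steps
    where
    J : Fin k → ℕ
    J l = I l + toℕ l * δ + ε
    first-entry : ∀ ℓ → toℕ ℓ ≡ 0 → J ℓ < q ^ (m ∸ 1)
    first-entry ℓ ℓ≡0 rewrite I₀≡0 ℓ ℓ≡0 | ℓ≡0 = ε<B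
    steps : ∀ ℓ ℓ' → toℕ ℓ' ≡ suc (toℕ ℓ) → (J ℓ ℕ.≤ J ℓ') × (J ℓ' ℕ.≤ J ℓ + q ^ (m ∸ 1))
    steps ℓ ℓ' ℓ'≡ℓ+1 with I-step ℓ ℓ' ℓ'≡ℓ+1
    ... | Iℓ≤Iℓ' , Iℓ'≤Iℓ+1 rewrite ℓ'≡ℓ+1 =
      ℕP.+-monoˡ-≤ ε (ℕP.+-mono-≤ Iℓ≤Iℓ' (ℕP.m≤n+m (toℕ ℓ * δ) δ)) ,
      (begin
        I ℓ' + (δ + toℕ ℓ * δ) + ε    ≤⟨ ℕP.+-monoˡ-≤ ε (ℕP.+-monoˡ-≤ (δ + toℕ ℓ * δ) Iℓ'≤Iℓ+1) ⟩
        I ℓ + 1 + (δ + toℕ ℓ * δ) + ε ≡⟨ regroup (I ℓ) (toℕ ℓ * δ) δ ε ⟩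
        J ℓ + suc δ                   ≤⟨ ℕP.+-monoʳ-≤ (J ℓ) δ<B ⟩
        J ℓ + q ^ (m ∸ 1)             ∎)
      where
      open ℕP.≤-Reasoning
      regroup : ∀ x y δ ε → x + 1 + (δ + y) + ε ≡ x + y + ε + suc δ
      regroup = solve 4 (λ x y δ ε → x :+ con 1 :+ (δ :+ y) :+ ε := x :+ y :+ ε :+ (con 1 :+ δ)) PE.refl
        where open ℕSolver.+-*-Solver

module Decomposition {c r} (R : CommutativeRing c r) (P : Params)
  (e : ℚ → Car R) (e-additive : ∀ x y → eqR R (e (x ℚ.+ y)) (mulR R (e x) (e y)))
  (qinv : Car R) (I : Fin (Params.k P) → ℕ) (h : ℤ) (d lam δ : ℕ) where

  open Params P
  open CommutativeRing R using (_≈_; reflexive; *-cong; *-comm; *-assoc; *-commutativeSemigroup)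
    renaming (_*_ to _⊛_; trans to ≈-trans; sym to ≈-sym; refl to ≈-refl)
  open RingSums R

  B N D : ℕ
  B = q ^ (m ∸ 1)
  N = lam + (m ∸ 1)
  D = B * d + δ

  q^N≡q^lam*B : q ^ N ≡ q ^ lam * B
  q^N≡q^lam*B = ℕP.^-distribˡ-+-* q lam (m ∸ 1)

  J : ℕ → Fin k → ℕ
  J ε l = I l + toℕ l * δ + ε

  digitSumH : ℕ → ℚ
  digitSumH u = sumFinℚ (λ l → α l ℚ.* toℚ (b lam (u + toℕ l * D + I l)))

  digitSumG : ℕ → ℕ → ℚ
  digitSumG ε u = sumFinℚ (λ l → α l ℚ.* toℚ (b lam (B * (u + toℕ l * d) + J ε l)))

  phaseH : ℕ → ℚ
  phaseH u = digitSumH u ℚ.- divPow (h ℤ.* + u) N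

  phaseG : ℕ → ℕ → ℚ
  phaseG ε u = digitSumG ε u ℚ.- divPow (h ℤ.* + u) lam

  twist : ℕ → Car R
  twist ε = e (ℚ.- divPow (h ℤ.* + ε) N)

  argument-regroup : ∀ u ε t i → (B * u + ε) + t * D + i ≡ B * (u + t * d) + (i + t * δ + ε)
  argument-regroup u ε t i = identity B d δ u ε t i
    where
    open ℕSolver.+-*-Solver
    identity : ∀ B d δ u ε t i → (B * u + ε) + t * (B * d + δ) + i ≡ B * (u + t * d) + (i + t * δ + ε)
    identity = solve 7 (λ B d δ u ε t i → (B :* u :+ ε) :+ t :* (B :* d :+ δ) :+ i
                                        := B :* (u :+ t :* d) :+ (i :+ t :* δ :+ ε)) PE.refl

  phase-split : ∀ u ε → divPow (h ℤ.* + (B * u + ε)) N ≡ divPow (h ℤ.* + u) lam ℚ.+ divPow (h ℤ.* + ε) N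
  phase-split u ε = begin
    divPow (h ℤ.* + (B * u + ε)) N
      ≡⟨ ℚP./-cong {{ℕP.m^n≢0 q N}} {{nonZero-q^lam*B}} numerator q^N≡q^lam*B ⟩
    ℚ._/_ ((h ℤ.* + u) ℤ.* + B ℤ.+ h ℤ.* + ε) (q ^ lam * B) {{nonZero-q^lam*B}}
      ≡⟨ fraction-split (h ℤ.* + u) (h ℤ.* + ε) (q ^ lam) B {{ℕP.m^n≢0 q lam}} {{ℕP.m^n≢0 q (m ∸ 1)}} ⟩
    divPow (h ℤ.* + u) lam ℚ.+ ℚ._/_ (h ℤ.* + ε) (q ^ lam * B) {{nonZero-q^lam*B}}
      ≡⟨ PE.cong (divPow (h ℤ.* + u) lam ℚ.+_)
           (ℚP./-cong {p₁ = h ℤ.* + ε} {{nonZero-q^lam*B}} {{ℕP.m^n≢0 q N}} PE.refl (PE.sym q^N≡q^lam*B)) ⟩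
    divPow (h ℤ.* + u) lam ℚ.+ divPow (h ℤ.* + ε) N ∎
    where
    open PE.≡-Reasoning
    nonZero-q^lam*B : NonZero (q ^ lam * B)
    nonZero-q^lam*B = ℕP.m*n≢0 (q ^ lam) B {{ℕP.m^n≢0 q lam}} {{ℕP.m^n≢0 q (m ∸ 1)}}
    numerator : h ℤ.* + (B * u + ε) ≡ (h ℤ.* + u) ℤ.* + B ℤ.+ h ℤ.* + ε
    numerator = PE.trans
      (PE.cong (h ℤ.*_) (PE.trans (ℤP.pos-+ (B * u) ε) (PE.cong (ℤ._+ + ε) (ℤP.pos-* B u))))
      (identity h (+ u) (+ ε) (+ B))
      where
      open ℤSolver.+-*-Solver
      identity : ∀ h u ε B → h ℤ.* (B ℤ.* u ℤ.+ ε) ≡ (h ℤ.* u) ℤ.* B ℤ.+ h ℤ.* ε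
      identity = solve 4 (λ h u ε B → h :* (B :* u :+ ε) := (h :* u) :* B :+ h :* ε) PE.refl

  phase-identity : ∀ u ε → phaseH (B * u + ε) ≡ ℚ.- divPow (h ℤ.* + ε) N ℚ.+ phaseG ε u
  phase-identity u ε = PE.trans
    (PE.cong₂ ℚ._-_ digitSum-regroup (phase-split u ε))
    (rearrange (digitSumG ε u) (divPow (h ℤ.* + u) lam) (divPow (h ℤ.* + ε) N))
    where
    digitSum-regroup : digitSumH (B * u + ε) ≡ digitSumG ε u
    digitSum-regroup = sumFinℚ-cong (λ l → PE.cong (λ n → α l ℚ.* toℚ (b lam n))
                                                  (argument-regroup u ε (toℕ l) (I l)))
    open ℚSolver.+-*-Solver
    rearrange : ∀ s x y → s ℚ.- (x ℚ.+ y) ≡ ℚ.- y ℚ.+ (s ℚ.- x)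
    rearrange = solve 3 (λ s x y → s :- (x :+ y) := :- y :+ (s :- x)) PE.refl

  summand-factor : ∀ u ε → e (phaseH (B * u + ε)) ≈ twist ε ⊛ e (phaseG ε u)
  summand-factor u ε = ≈-trans (reflexive (PE.cong e (phase-identity u ε))) (e-additive _ _)

  sum-decomposition : Σ (q ^ N) (λ u → e (phaseH u))
                    ≈ Σ B (λ ε → twist ε ⊛ Σ (q ^ lam) (λ u → e (phaseG ε u)))
  sum-decomposition = begin
    Σ (q ^ N) (λ u → e (phaseH u))
      ≡⟨ PE.cong (λ n → Σ n (λ u → e (phaseH u))) q^N≡q^lam*B ⟩
    Σ (q ^ lam * B) (λ u → e (phaseH u))
      ≈⟨ sum-blocks (q ^ lam) B _ ⟩
    Σ (q ^ lam) (λ u → Σ B (λ ε → e (phaseH (B * u + ε))))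
      ≈⟨ sum-swap (q ^ lam) B _ ⟩
    Σ B (λ ε → Σ (q ^ lam) (λ u → e (phaseH (B * u + ε))))
      ≈⟨ sum-cong B (λ ε → ≈-trans (sum-cong (q ^ lam) (λ u → summand-factor u ε))
                                    (≈-sym (sum-*ˡ (q ^ lam) (twist ε) _))) ⟩
    Σ B (λ ε → twist ε ⊛ Σ (q ^ lam) (λ u → e (phaseG ε u))) ∎
    where open SetoidReasoning (CommutativeRing.setoid R)

  H-decomposition : H R P e qinv lam I h D
                  ≈ powR R qinv (m ∸ 1) ⊛ Σ B (λ ε → twist ε ⊛ G R P e qinv lam (J ε) h d)
  H-decomposition = begin
    powR R qinv N ⊛ Σ (q ^ N) (λ u → e (phaseH u))
      ≈⟨ *-cong (pow-+ qinv lam (m ∸ 1)) sum-decomposition ⟩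
    (Qλ ⊛ Qm) ⊛ Σ B (λ ε → twist ε ⊛ Gsum ε)
      ≈⟨ ≈-trans (*-cong (*-comm Qλ Qm) ≈-refl) (*-assoc Qm Qλ _) ⟩
    Qm ⊛ (Qλ ⊛ Σ B (λ ε → twist ε ⊛ Gsum ε))
      ≈⟨ *-cong ≈-refl (≈-trans (sum-*ˡ B Qλ _) (sum-cong B (λ ε → x∙yz≈y∙xz Qλ (twist ε) (Gsum ε)))) ⟩
    Qm ⊛ Σ B (λ ε → twist ε ⊛ (Qλ ⊛ Gsum ε)) ∎
    where
    open SetoidReasoning (CommutativeRing.setoid R)
    open CommSemigroupProps *-commutativeSemigroup using (x∙yz≈y∙xz)
    Qλ Qm : Car R
    Qλ = powR R qinv lam
    Qm = powR R qinv (m ∸ 1)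
    Gsum : ℕ → Car R
    Gsum ε = Σ (q ^ lam) (λ u → e (phaseG ε u))

lemma8 : ∀ {c r} (R : CommutativeRing c r) (P : Params) →
    let open Params P
    in (e : ℚ → Car R) → IsCharacter R e →
    (qinv : Car R) → eqR R (mulR R (natR R q) qinv) (oneR R) →
    (I : Fin k → ℕ) → InI' I →
    (h : ℤ) (d lam δ : ℕ) → δ < q ^ (m ∸ 1) →
    (∀ ε → ε < q ^ (m ∸ 1) → InI (λ l → I l + toℕ l * δ + ε))
    × eqR R (H R P e qinv lam I h (q ^ (m ∸ 1) * d + δ))
    (mulR R (powR R qinv (m ∸ 1))
    (sumR R (q ^ (m ∸ 1)) (λ ε →
    mulR R (e (ℚ.- divPow (h ℤ.* + ε) (lam + (m ∸ 1))))
    (G R P e qinv lam (λ l → I l + toℕ l * δ + ε) h d))))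
lemma8 R P e (e-additive , _) qinv _ I I∈I' h d lam δ δ<B =
  (λ ε ε<B → shifted-in-I P I I∈I' δ ε δ<B ε<B) ,
  Decomposition.H-decomposition R P e e-additive qinv I h d lam δ
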